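{- For every $n\ge 1$, the number of permutations of $\{1,\dots,n\}$ whose Schröder insertion tableau has a single column (every row has at most two cells) is $2^{n-1}$.
   Context: A (partial) Schröder tableau is stored as a sequence of rows; row $r$ is a sequence of cells at positions $1,\dots,\ell_r$, each containing a number; odd positions are upper triangles, even positions lower triangles. Schröder insertion of $\alpha$: set $i=1$ and repeat: if row $i$ does not exist or $\alpha$ exceeds every entry of row $i$, append a new cell containing $\alpha$ at the end of row $i$ and stop. Otherwise let $j$ be the position in row $i$ of the smallest entry $\gamma>\alpha$. If $j$ is even, write $\alpha$ at $j$, set $\alpha:=\gamma$, $i:=i+1$, repeat. If $j$ is odd and last in row $i$, write $\alpha$ at $j$, append a new cell at position $j+1$ containing $\gamma$, stop. If $j$ is odd and not last, let $\beta$ be the entry at $j+1$; write $\alpha$ at $j$ and $\gamma$ at $j+1$, set $\alpha:=\beta$, $i:=i+1$, repeat. The Schröder insertion tableau of $\pi=\pi_1\cdots\pi_n$ is obtained from the one-cell tableau containing $\pi_1$ by successively inserting $\pi_2,\dots,\pi_n$. -}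

module Defs where

open import Data.Nat using (ℕ; zero; suc; _<ᵇ_; _≡ᵇ_; _%_; _≤_)
open import Data.Bool using (Bool; true; false; if_then_else_)
open import Data.List using (List; []; _∷_; _++_; [_]; length; foldl; upTo; map)
open import Data.List.Relation.Unary.All using (All)
open import Data.Maybe using (Maybe; just; nothing)
open import Data.Product using (_×_; _,_)

-- A (partial) Schröder tableau: a list of rows; each row is a list of cells
-- at positions 1,…,ℓ (odd positions = upper triangles, even = lower).
Row : Set
Row = List ℕ

Tableau : Set
Tableau = List Row

-- (position, value) of the smallest entry γ > α of a row, positions 1-indexed
-- starting from k.  (For ties the first occurrence is taken; entries of
-- tableaux of permutations are distinct.)
smallestAbove : ℕ → Row → ℕ → Maybe (ℕ × ℕ)
smallestAbove α [] k = nothing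
smallestAbove α (x ∷ xs) k with smallestAbove α xs (suc k) | α <ᵇ x
... | r              | false = r
... | nothing        | true  = just (k , x)
... | just (j , y)   | true  = if y <ᵇ x then just (j , y) else just (k , x)

setAt : ℕ → ℕ → Row → Row
setAt j v [] = []
setAt zero v (x ∷ xs) = x ∷ xs
setAt (suc zero) v (x ∷ xs) = v ∷ xs
setAt (suc (suc j)) v (x ∷ xs) = x ∷ setAt (suc j) v xs

-- entry at (1-indexed) position j (0 if absent; never used out of range)
getAt : ℕ → Row → ℕ
getAt j [] = 0
getAt zero (x ∷ xs) = 0
getAt (suc zero) (x ∷ xs) = x
getAt (suc (suc j)) (x ∷ xs) = getAt (suc j) xs

isEven : ℕ → Bool
isEven j = j % 2 ≡ᵇ 0

data Step : Set where
  stop : Row → Step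
  bump : Row → ℕ → Step      -- new row, value to insert into next row

rowStep : ℕ → Row → Step
rowStep α row with smallestAbove α row 1
... | nothing = stop (row ++ [ α ])
... | just (j , γ) =
  if isEven j then bump (setAt j α row) γ
  else (if j ≡ᵇ length row
        then stop (setAt j α row ++ [ γ ])
        else bump (setAt (suc j) γ (setAt j α row)) (getAt (suc j) row))

schroderInsert : ℕ → Tableau → Tableau
schroderInsert α [] = [ α ] ∷ []
schroderInsert α (r ∷ rs) with rowStep α r
... | stop r'    = r' ∷ rs
... | bump r' α' = r' ∷ schroderInsert α' rs

insertionTableau : List ℕ → Tableau
insertionTableau [] = []
insertionTableau (x ∷ xs) = foldl (λ T a → schroderInsert a T) ([ x ] ∷ []) xs

SingleColumn : Tableau → Set
SingleColumn T = All (λ r → length r ≤ 2) T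

oneTo : ℕ → List ℕ
oneTo n = map suc (upTo n)

-- Call a word sparse if each of its letters is preceded by at most one smaller
-- letter.  Inserting a duplicate-free sparse word keeps the tableau a column of
-- rows (a, b) with a < b whose entries increase downwards: a new letter α below
-- the second entry b of the first row only pushes the second entry of every row
-- one row down.  Because a and b are the two smallest entries so far, α exceeds b
-- exactly when two earlier letters are smaller than α, and then α is appended as
-- a third cell of the first row, which can never disappear again.  Hence the
-- single-column permutations are the sparse ones.  In a sparse permutation of
-- 1, …, n the letter n is in position 1 or 2, and deleting it leaves a sparse
-- permutation of 1, …, n - 1, so there are 2^(n-1) of them.

module Submission where

open import Defs
open import Data.Bool using (true; false; T)
open import Data.Bool.Properties using (T-≡)
open import Data.Nat using (ℕ; zero; suc; _^_; _≥_; _∸_; _<_; _≤_; _+_; z≤n; s≤s; _<ᵇ_; _≡ᵇ_)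
open import Data.Nat.Properties
open import Data.Maybe using (just; nothing)
open import Data.Unit using (⊤; tt)
open import Data.List using (List; []; _∷_; _++_; [_]; length; map; concat; foldl; upTo)
open import Data.List.Properties using (length-++; length-++-≤ˡ; length-map; map-++; upTo-∷ʳ; ∷-injectiveʳ)
open import Data.List.Membership.Propositional using (_∈_; _∉_)
open import Data.List.Membership.Propositional.Properties using (∈-map⁺; ∈-map⁻; ∈-++⁺ˡ; ∈-++⁺ʳ; ∈-++⁻; ∈-upTo⁻)
open import Data.List.Relation.Unary.Any using (here; there)
open import Data.List.Relation.Unary.All using (All; []; _∷_)
import Data.List.Relation.Unary.All as All
open import Data.List.Relation.Unary.All.Properties using (All¬⇒¬Any; ++⁻ˡ)
open import Data.List.Relation.Unary.AllPairs using ([]; _∷_)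
open import Data.List.Relation.Unary.Unique.Propositional using (Unique)
open import Data.List.Relation.Unary.Unique.Propositional.Properties using (++⁺; map⁺; upTo⁺)
open import Data.List.Relation.Binary.Subset.Propositional using (_⊆_)
open import Data.List.Relation.Binary.Subset.Propositional.Properties using (⊆-reflexive-↭; ∷⁺ʳ)
open import Data.List.Relation.Binary.Permutation.Propositional
  using (_↭_; prep; swap; ↭-refl; ↭-sym; ↭-trans; ↭⇒↭ₛ; module PermutationReasoning)
open import Data.List.Relation.Binary.Permutation.Propositional.Properties
  using (∈-resp-↭; drop-∷; ↭-singleton-inv; ∷↭∷ʳ; shift)
open import Data.List.Relation.Binary.Permutation.Setoid.Properties using (Unique-resp-↭)
open import Data.Product using (Σ; ∃; ∃₂; _×_; _,_; proj₁; proj₂)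
open import Data.Sum using (_⊎_; inj₁; inj₂)
open import Function.Bundles using (_⇔_; mk⇔; Equivalence)
open import Relation.Binary using (tri<; tri≈; tri>)
open import Relation.Binary.PropositionalEquality using (_≡_; refl; sym; trans; cong; cong₂; subst; setoid; module ≡-Reasoning)
open import Relation.Nullary using (¬_; yes; no; contradiction)

open Equivalence using (to; from)

<ᵇ-true : ∀ {m n} → m < n → (m <ᵇ n) ≡ true
<ᵇ-true m<n = to T-≡ (<⇒<ᵇ m<n)

<ᵇ-false : ∀ {m n} → n ≤ m → (m <ᵇ n) ≡ false
<ᵇ-false {m} {n} n≤m with m <ᵇ n in eq
... | false = refl
... | true  = contradiction (<ᵇ⇒< m n (subst T (sym eq) tt)) (≤⇒≯ n≤m)

rowStep-single-< : ∀ {α a} → α < a → rowStep α [ a ] ≡ stop (α ∷ a ∷ [])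
rowStep-single-< α<a rewrite <ᵇ-true α<a = refl

rowStep-single-> : ∀ {α a} → a < α → rowStep α [ a ] ≡ stop (a ∷ α ∷ [])
rowStep-single-> a<α rewrite <ᵇ-false (<⇒≤ a<α) = refl

rowStep-pair-< : ∀ {α a b} → α < a → a < b → rowStep α (a ∷ b ∷ []) ≡ bump (α ∷ a ∷ []) b
rowStep-pair-< α<a a<b
  rewrite <ᵇ-true (<-trans α<a a<b) | <ᵇ-true α<a | <ᵇ-false (<⇒≤ a<b) = refl

rowStep-pair-mid : ∀ {α a b} → a < α → α < b → rowStep α (a ∷ b ∷ []) ≡ bump (a ∷ α ∷ []) b
rowStep-pair-mid a<α α<b rewrite <ᵇ-true α<b | <ᵇ-false (<⇒≤ a<α) = refl

rowStep-pair-> : ∀ {α a b} → a < b → b < α → rowStep α (a ∷ b ∷ []) ≡ stop (a ∷ b ∷ α ∷ [])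
rowStep-pair-> a<b b<α rewrite <ᵇ-false (<⇒≤ b<α) | <ᵇ-false (<⇒≤ (<-trans a<b b<α)) = refl

data Chain : ℕ → Tableau → Set where
  []     : ∀ {lb} → Chain lb []
  single : ∀ {lb a} → lb ≤ a → Chain lb ([ a ] ∷ [])
  pair   : ∀ {lb a b rs} → lb ≤ a → a < b → Chain (suc b) rs → Chain lb ((a ∷ b ∷ []) ∷ rs)

Chain⇒SingleColumn : ∀ {lb T} → Chain lb T → SingleColumn T
Chain⇒SingleColumn []            = []
Chain⇒SingleColumn (single _)    = s≤s z≤n ∷ []
Chain⇒SingleColumn (pair _ _ ch) = s≤s (s≤s z≤n) ∷ Chain⇒SingleColumn ch

Chain-≤ : ∀ {lb T e} → Chain lb T → e ∈ concat T → lb ≤ e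
Chain-≤ (single lb≤a)       (here refl)         = lb≤a
Chain-≤ (pair lb≤a _ _)     (here refl)         = lb≤a
Chain-≤ (pair lb≤a a<b _)   (there (here refl)) = ≤-trans lb≤a (<⇒≤ a<b)
Chain-≤ (pair lb≤a a<b ch)  (there (there e∈))  = ≤-trans lb≤a (<⇒≤ (<-trans a<b (Chain-≤ ch e∈)))

Chain-insert-< : ∀ {lb α T} → lb ≤ α → Chain (suc α) T →
  Chain lb (schroderInsert α T) × concat (schroderInsert α T) ↭ α ∷ concat T
Chain-insert-< lb≤α [] = single lb≤α , ↭-refl
Chain-insert-< lb≤α (single α<a) rewrite rowStep-single-< α<a = pair lb≤α α<a [] , ↭-refl
Chain-insert-< {α = α} lb≤α (pair {a = a} α<a a<b ch) rewrite rowStep-pair-< α<a a<b =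
  let ch′ , ↭′ = Chain-insert-< a<b ch in pair lb≤α α<a ch′ , prep α (prep a ↭′)

BelowSecond : ℕ → Tableau → Set
BelowSecond α ((a ∷ b ∷ []) ∷ rs) = α < b
BelowSecond α _                   = ⊤

Chain-insert : ∀ {α T} → Chain 0 T → α ∉ concat T → BelowSecond α T →
  Chain 0 (schroderInsert α T) × concat (schroderInsert α T) ↭ α ∷ concat T
Chain-insert [] _ _ = single z≤n , ↭-refl
Chain-insert {α} (single {a = a} _) α∉ _ with <-cmp α a
... | tri< α<a _ _ rewrite rowStep-single-< α<a = pair z≤n α<a [] , ↭-refl
... | tri≈ _ α≡a _ = contradiction (here α≡a) α∉
... | tri> _ _ a<α rewrite rowStep-single-> a<α = pair z≤n a<α [] , swap a α ↭-refl
Chain-insert {α} (pair {a = a} _ a<b ch) α∉ α<b with <-cmp α a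
... | tri< α<a _ _ rewrite rowStep-pair-< α<a a<b =
  let ch′ , ↭′ = Chain-insert-< a<b ch in pair z≤n α<a ch′ , prep α (prep a ↭′)
... | tri≈ _ α≡a _ = contradiction (here α≡a) α∉
... | tri> _ _ a<α rewrite rowStep-pair-mid a<α α<b =
  let ch′ , ↭′ = Chain-insert-< α<b ch in pair z≤n a<α ch′ , swap a α ↭′

SingleColumn-insert⇒BelowSecond : ∀ {α T} → Chain 0 T → α ∉ concat T →
  SingleColumn (schroderInsert α T) → BelowSecond α T
SingleColumn-insert⇒BelowSecond [] _ _ = tt
SingleColumn-insert⇒BelowSecond (single _) _ _ = tt
SingleColumn-insert⇒BelowSecond {α} (pair {b = b} _ a<b _) α∉ sc with <-cmp α b
... | tri< α<b _ _ = α<b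
... | tri≈ _ α≡b _ = contradiction (there (here α≡b)) α∉
... | tri> _ _ b<α rewrite rowStep-pair-> a<b b<α with sc
...   | s≤s (s≤s ()) ∷ _

AtMostOneBelow : ℕ → List ℕ → Set
AtMostOneBelow α p = ∀ {y z} → y ∈ p → z ∈ p → y < α → z < α → y ≡ z

AtMostOneBelow-[_] : ∀ {α} x → AtMostOneBelow α [ x ]
AtMostOneBelow-[ x ] (here refl) (here refl) _ _ = refl

AtMostOneBelow-⊆ : ∀ {α p q} → q ⊆ p → AtMostOneBelow α p → AtMostOneBelow α q
AtMostOneBelow-⊆ q⊆p amo y∈q z∈q = amo (q⊆p y∈q) (q⊆p z∈q)

AtMostOneBelow-∷ : ∀ {α m p} → α ≤ m → AtMostOneBelow α p → AtMostOneBelow α (m ∷ p)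
AtMostOneBelow-∷ α≤m amo (here refl) _ y<α _ = contradiction α≤m (<⇒≱ y<α)
AtMostOneBelow-∷ α≤m amo (there _) (here refl) _ z<α = contradiction α≤m (<⇒≱ z<α)
AtMostOneBelow-∷ α≤m amo (there y∈p) (there z∈p) = amo y∈p z∈p

-- In a chain, the entries a, b of the first row are the two smallest entries.
AtMostOneBelow⇔BelowSecond : ∀ {α T} → Chain 0 T → α ∉ concat T →
  AtMostOneBelow α (concat T) ⇔ BelowSecond α T
AtMostOneBelow⇔BelowSecond [] _ = mk⇔ (λ _ → tt) (λ _ ())
AtMostOneBelow⇔BelowSecond (single {a = a} _) _ = mk⇔ (λ _ → tt) (λ _ {_} {_} → AtMostOneBelow-[ a ])
AtMostOneBelow⇔BelowSecond {α} (pair {a = a} {b} {rs} _ a<b ch) α∉ = mk⇔ below-second only-first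
  where
  below-second : AtMostOneBelow α (a ∷ b ∷ concat rs) → α < b
  below-second amo with <-cmp α b
  ... | tri< α<b _ _ = α<b
  ... | tri≈ _ α≡b _ = contradiction (there (here α≡b)) α∉
  ... | tri> _ _ b<α = contradiction (amo (here refl) (there (here refl)) (<-trans a<b b<α) b<α) (<⇒≢ a<b)

  first : ∀ {y} → y ∈ a ∷ b ∷ concat rs → y < b → y ≡ a
  first (here y≡a)          _   = y≡a
  first (there (here refl)) y<b = contradiction refl (<⇒≢ y<b)
  first (there (there y∈))  y<b = contradiction (<-trans y<b (Chain-≤ ch y∈)) (<-irrefl refl)

  only-first : α < b → AtMostOneBelow α (a ∷ b ∷ concat rs)
  only-first α<b y∈ z∈ y<α z<α = trans (first y∈ (<-trans y<α α<b)) (sym (first z∈ (<-trans z<α α<b)))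

length-setAt : ∀ j v r → length (setAt j v r) ≡ length r
length-setAt j             v []      = refl
length-setAt zero          v (x ∷ r) = refl
length-setAt (suc zero)    v (x ∷ r) = refl
length-setAt (suc (suc j)) v (x ∷ r) = cong suc (length-setAt (suc j) v r)

newRow : Step → Row
newRow (stop r)   = r
newRow (bump r _) = r

rowStep-length : ∀ α r → length r ≤ length (newRow (rowStep α r))
rowStep-length α r with smallestAbove α r 1
... | nothing = length-++-≤ˡ r
... | just (j , γ) with isEven j
...   | true = ≤-reflexive (sym (length-setAt j α r))
...   | false with j ≡ᵇ length r
...     | true = ≤-trans (≤-reflexive (sym (length-setAt j α r))) (length-++-≤ˡ (setAt j α r))
...     | false = ≤-reflexive (sym (trans (length-setAt (suc j) γ (setAt j α r)) (length-setAt j α r)))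

SingleColumn-insert⁻ : ∀ α T → SingleColumn (schroderInsert α T) → SingleColumn T
SingleColumn-insert⁻ α [] _ = []
SingleColumn-insert⁻ α (r ∷ rs) sc with rowStep α r | rowStep-length α r | sc
... | stop r′    | r≤r′ | r′≤2 ∷ rs-sc = ≤-trans r≤r′ r′≤2 ∷ rs-sc
... | bump r′ α′ | r≤r′ | r′≤2 ∷ rs-sc = ≤-trans r≤r′ r′≤2 ∷ SingleColumn-insert⁻ α′ rs rs-sc

insertAll : Tableau → List ℕ → Tableau
insertAll = foldl (λ T a → schroderInsert a T)

SingleColumn-insertAll⁻ : ∀ T xs → SingleColumn (insertAll T xs) → SingleColumn T
SingleColumn-insertAll⁻ T []       sc = sc
SingleColumn-insertAll⁻ T (α ∷ xs) sc =
  SingleColumn-insert⁻ α T (SingleColumn-insertAll⁻ (schroderInsert α T) xs sc)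

-- p holds the letters read before σ, most recent first.
AtMostOneSmallerBefore : List ℕ → List ℕ → Set
AtMostOneSmallerBefore p []      = ⊤
AtMostOneSmallerBefore p (α ∷ σ) = AtMostOneBelow α p × AtMostOneSmallerBefore (α ∷ p) σ

AtMostOneSmallerBefore-⊆ : ∀ {p q} σ → q ⊆ p → AtMostOneSmallerBefore p σ → AtMostOneSmallerBefore q σ
AtMostOneSmallerBefore-⊆ []      _   _           = tt
AtMostOneSmallerBefore-⊆ (α ∷ σ) q⊆p (amo , rest) =
  AtMostOneBelow-⊆ q⊆p amo , AtMostOneSmallerBefore-⊆ σ (∷⁺ʳ α q⊆p) rest

AtMostOneSmallerBefore-∷ : ∀ {m p σ} → All (_≤ m) σ → AtMostOneSmallerBefore p σ → AtMostOneSmallerBefore (m ∷ p) σ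
AtMostOneSmallerBefore-∷ []                       _            = tt
AtMostOneSmallerBefore-∷ {m} {σ = α ∷ σ} (α≤m ∷ σ≤m) (amo , rest) =
  AtMostOneBelow-∷ α≤m amo ,
  AtMostOneSmallerBefore-⊆ σ (⊆-reflexive-↭ (swap α m ↭-refl)) (AtMostOneSmallerBefore-∷ σ≤m rest)

AtMostOneSmallerBefore-∈ : ∀ {m p σ} → AtMostOneSmallerBefore p σ → m ∈ σ → AtMostOneBelow m p
AtMostOneSmallerBefore-∈ {σ = _ ∷ _} (amo , _)  (here refl) = amo
AtMostOneSmallerBefore-∈ {σ = _ ∷ _} (_ , rest) (there m∈σ) = AtMostOneBelow-⊆ there (AtMostOneSmallerBefore-∈ rest m∈σ)

insertAll-SingleColumn⇔ : ∀ {p T} xs → Chain 0 T → concat T ↭ p → Unique (p ++ xs) →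
  AtMostOneSmallerBefore p xs ⇔ SingleColumn (insertAll T xs)
insertAll-SingleColumn⇔ [] ch _ _ = mk⇔ (λ _ → Chain⇒SingleColumn ch) (λ _ → tt)
insertAll-SingleColumn⇔ {p} {T} (α ∷ xs) ch T↭p u = mk⇔ sparse⇒column column⇒sparse
  where
  u′ : Unique (α ∷ p ++ xs)
  u′ = Unique-resp-↭ (setoid ℕ) (↭⇒↭ₛ (shift α p xs)) u

  α∉T : α ∉ concat T
  α∉T α∈T with u′
  ... | α∉ ∷ _ = All¬⇒¬Any (++⁻ˡ p α∉) (∈-resp-↭ T↭p α∈T)

  below⇔ : AtMostOneBelow α (concat T) ⇔ BelowSecond α T
  below⇔ = AtMostOneBelow⇔BelowSecond ch α∉T

  after : BelowSecond α T →
    AtMostOneSmallerBefore (α ∷ p) xs ⇔ SingleColumn (insertAll (schroderInsert α T) xs)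
  after below = let ch′ , ↭′ = Chain-insert ch α∉T below in
                insertAll-SingleColumn⇔ xs ch′ (↭-trans ↭′ (prep α T↭p)) u′

  sparse⇒column : AtMostOneSmallerBefore p (α ∷ xs) → SingleColumn (insertAll T (α ∷ xs))
  sparse⇒column (amo , rest) = to (after (to below⇔ (AtMostOneBelow-⊆ (⊆-reflexive-↭ T↭p) amo))) rest

  column⇒sparse : SingleColumn (insertAll T (α ∷ xs)) → AtMostOneSmallerBefore p (α ∷ xs)
  column⇒sparse sc = AtMostOneBelow-⊆ (⊆-reflexive-↭ (↭-sym T↭p)) (from below⇔ below) , from (after below) sc
    where
    below : BelowSecond α T
    below = SingleColumn-insert⇒BelowSecond ch α∉T (SingleColumn-insertAll⁻ _ xs sc)

insertionTableau-SingleColumn⇔ : ∀ {π} → Unique π →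
  AtMostOneSmallerBefore [] π ⇔ SingleColumn (insertionTableau π)
insertionTableau-SingleColumn⇔ {[]}     _ = mk⇔ (λ _ → []) (λ _ → tt)
insertionTableau-SingleColumn⇔ {x ∷ xs} u =
  mk⇔ (λ (_ , rest) → to inserted rest) (λ sc → (λ ()) , from inserted sc)
  where
  inserted : AtMostOneSmallerBefore [ x ] xs ⇔ SingleColumn (insertionTableau (x ∷ xs))
  inserted = insertAll-SingleColumn⇔ xs (single z≤n) ↭-refl u

max-position : ∀ {m π} → Unique π → m ∈ π → All (_≤ m) π → AtMostOneSmallerBefore [] π →
  (∃ λ σ → π ≡ m ∷ σ) ⊎ (∃₂ λ x σ → π ≡ x ∷ m ∷ σ)
max-position {m} {x ∷ π} _ m∈ _ _ with x ≟ m
... | yes refl = inj₁ (π , refl)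
max-position {m} {x ∷ []} _ (here m≡x) _ _ | no x≢m = contradiction (sym m≡x) x≢m
max-position {m} {x ∷ y ∷ π} ((x≢y ∷ _) ∷ _) m∈ (x≤m ∷ y≤m ∷ _) (_ , _ , rest) | no x≢m with y ≟ m
... | yes refl = inj₂ (x , π , refl)
... | no y≢m with m∈
...   | here m≡x         = contradiction (sym m≡x) x≢m
...   | there (here m≡y) = contradiction (sym m≡y) y≢m
...   | there (there m∈π) =
  contradiction (AtMostOneSmallerBefore-∈ rest m∈π (there (here refl)) (here refl) (≤∧≢⇒< x≤m x≢m) (≤∧≢⇒< y≤m y≢m)) x≢y

oneTo-suc : ∀ n → oneTo (suc n) ↭ suc n ∷ oneTo n
oneTo-suc n = begin
  map suc (upTo (suc n))  ≡⟨ cong (map suc) (upTo-∷ʳ n) ⟨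
  map suc (upTo n ++ [ n ]) ≡⟨ map-++ suc (upTo n) [ n ] ⟩
  oneTo n ++ [ suc n ]    ↭⟨ ∷↭∷ʳ (suc n) (oneTo n) ⟨
  suc n ∷ oneTo n         ∎
  where open PermutationReasoning

oneTo-≤ : ∀ {n e} → e ∈ oneTo n → e ≤ n
oneTo-≤ e∈ with ∈-map⁻ suc e∈
... | i , i∈ , refl = ∈-upTo⁻ i∈

oneTo-unique : ∀ n → Unique (oneTo n)
oneTo-unique n = map⁺ suc-injective (upTo⁺ n)

↭-oneTo⇒unique : ∀ {n π} → π ↭ oneTo n → Unique π
↭-oneTo⇒unique {n} π↭ = Unique-resp-↭ (setoid ℕ) (↭⇒↭ₛ (↭-sym π↭)) (oneTo-unique n)

↭-oneTo⇒≤ : ∀ {n π} → π ↭ oneTo n → All (_≤ n) π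
↭-oneTo⇒≤ π↭ = All.tabulate (λ e∈ → oneTo-≤ (∈-resp-↭ π↭ e∈))

↭-oneTo⇒suc∈ : ∀ {n π} → π ↭ oneTo (suc n) → suc n ∈ π
↭-oneTo⇒suc∈ {n} π↭ = ∈-resp-↭ (↭-sym (↭-trans π↭ (oneTo-suc n))) (here refl)

insertSecond : ℕ → List ℕ → List ℕ
insertSecond m []       = [ m ]
insertSecond m (x ∷ xs) = x ∷ m ∷ xs

insertSecond-↭ : ∀ m τ → insertSecond m τ ↭ m ∷ τ
insertSecond-↭ m []      = ↭-refl
insertSecond-↭ m (x ∷ τ) = swap x m ↭-refl

insertSecond-injective : ∀ {m σ τ} → insertSecond m σ ≡ insertSecond m τ → σ ≡ τ
insertSecond-injective {σ = []}    {[]}    refl = refl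
insertSecond-injective {σ = _ ∷ _} {_ ∷ _} refl = refl

AtMostOneSmallerBefore-insertSecond : ∀ {m τ} → All (_≤ m) τ →
  AtMostOneSmallerBefore [] τ → AtMostOneSmallerBefore [] (insertSecond m τ)
AtMostOneSmallerBefore-insertSecond {m} {[]}    _           _        = (λ ()) , tt
AtMostOneSmallerBefore-insertSecond {m} {x ∷ τ} (_ ∷ τ≤m) (_ , rest) =
  (λ ()) , AtMostOneBelow-[ x ] , AtMostOneSmallerBefore-∷ τ≤m rest

-- Indexed by n - 1: columnWords k consists of the sparse permutations of 1, …, k + 1.
columnWords : ℕ → List (List ℕ)
columnWords zero    = [ [ 1 ] ]
columnWords (suc k) = map (suc (suc k) ∷_) (columnWords k) ++ map (insertSecond (suc (suc k))) (columnWords k)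

∈-columnWords⁻ : ∀ k {π} → π ∈ columnWords k → π ↭ oneTo (suc k) × AtMostOneSmallerBefore [] π
∈-columnWords⁻ zero (here refl) = ↭-refl , (λ ()) , tt
∈-columnWords⁻ (suc k) π∈ with ∈-++⁻ (map (suc (suc k) ∷_) (columnWords k)) π∈
... | inj₁ π∈ˡ with ∈-map⁻ (suc (suc k) ∷_) π∈ˡ
...   | σ , σ∈ , refl =
  let σ↭ , sparse = ∈-columnWords⁻ k σ∈ in
  ↭-trans (prep _ σ↭) (↭-sym (oneTo-suc (suc k))) ,
  (λ ()) , AtMostOneSmallerBefore-∷ (All.map m≤n⇒m≤1+n (↭-oneTo⇒≤ σ↭)) sparse
∈-columnWords⁻ (suc k) π∈ | inj₂ π∈ʳ with ∈-map⁻ (insertSecond (suc (suc k))) π∈ʳ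
...   | τ , τ∈ , refl =
  let τ↭ , sparse = ∈-columnWords⁻ k τ∈ in
  ↭-trans (insertSecond-↭ _ τ) (↭-trans (prep _ τ↭) (↭-sym (oneTo-suc (suc k)))) ,
  AtMostOneSmallerBefore-insertSecond (All.map m≤n⇒m≤1+n (↭-oneTo⇒≤ τ↭)) sparse

∈-columnWords⁺ : ∀ k {π} → π ↭ oneTo (suc k) → AtMostOneSmallerBefore [] π → π ∈ columnWords k
∈-columnWords⁺ zero π↭ _ with ↭-singleton-inv π↭
... | refl = here refl
∈-columnWords⁺ (suc k) π↭ sparse
  with max-position (↭-oneTo⇒unique π↭) (↭-oneTo⇒suc∈ π↭) (↭-oneTo⇒≤ π↭) sparse
... | inj₁ (σ , refl) =
  ∈-++⁺ˡ (∈-map⁺ _ (∈-columnWords⁺ k (drop-∷ (↭-trans π↭ (oneTo-suc (suc k))))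
                                       (AtMostOneSmallerBefore-⊆ σ (λ ()) (proj₂ sparse))))
... | inj₂ (x , σ , refl) =
  ∈-++⁺ʳ _ (∈-map⁺ (insertSecond _) {x ∷ σ}
    (∈-columnWords⁺ k (drop-∷ (↭-trans (swap _ x ↭-refl) (↭-trans π↭ (oneTo-suc (suc k)))))
                      ((λ ()) , AtMostOneSmallerBefore-⊆ σ there (proj₂ (proj₂ sparse)))))

columnWords-unique : ∀ k → Unique (columnWords k)
columnWords-unique zero    = [] ∷ []
columnWords-unique (suc k) =
  ++⁺ (map⁺ ∷-injectiveʳ (columnWords-unique k)) (map⁺ insertSecond-injective (columnWords-unique k)) disjoint
  where
  M : ℕ
  M = suc (suc k)

  no-empty : [] ∉ columnWords k
  no-empty []∈ with ∈-resp-↭ (↭-sym (proj₁ (∈-columnWords⁻ k []∈))) (here refl)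
  ... | ()

  disjoint : ∀ {v} → ¬ (v ∈ map (M ∷_) (columnWords k) × v ∈ map (insertSecond M) (columnWords k))
  disjoint (v∈ˡ , v∈ʳ) with ∈-map⁻ (M ∷_) v∈ˡ | ∈-map⁻ (insertSecond M) v∈ʳ
  ... | _ , []∈ , refl | [] , _ , refl = no-empty []∈
  ... | _ , _ , refl | _ ∷ _ , Mτ∈ , refl =
    <-irrefl refl (oneTo-≤ (∈-resp-↭ (proj₁ (∈-columnWords⁻ k Mτ∈)) (here refl)))

length-columnWords : ∀ k → length (columnWords k) ≡ 2 ^ k
length-columnWords zero    = refl
length-columnWords (suc k) = begin
  length (map (M ∷_) W ++ map (insertSecond M) W)              ≡⟨ length-++ (map (M ∷_) W) ⟩
  length (map (M ∷_) W) + length (map (insertSecond M) W)      ≡⟨ cong₂ _+_ (length-map _ W) (length-map _ W) ⟩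
  length W + length W                                          ≡⟨ cong₂ _+_ (length-columnWords k) (length-columnWords k) ⟩
  2 ^ k + 2 ^ k                                                ≡⟨ cong (2 ^ k +_) (+-identityʳ (2 ^ k)) ⟨
  2 ^ suc k                                                    ∎
  where
  open ≡-Reasoning
  M : ℕ
  M = suc (suc k)
  W : List (List ℕ)
  W = columnWords k

mainTheorem9 : (n : ℕ) → n ≥ 1 →
    Σ (List (List ℕ)) (λ L →
      Unique L ×
      ((π : List ℕ) → (π ∈ L) ⇔ ((π ↭ oneTo n) × SingleColumn (insertionTableau π))) ×
      length L ≡ 2 ^ (n ∸ 1))
mainTheorem9 (suc k) _ = columnWords k , columnWords-unique k , members , length-columnWords k
  where
  members : (π : List ℕ) → π ∈ columnWords k ⇔ (π ↭ oneTo (suc k) × SingleColumn (insertionTableau π))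
  members π = mk⇔
    (λ π∈ → let π↭ , sparse = ∈-columnWords⁻ k π∈ in
            π↭ , to (insertionTableau-SingleColumn⇔ (↭-oneTo⇒unique π↭)) sparse)
    (λ (π↭ , sc) → ∈-columnWords⁺ k π↭ (from (insertionTableau-SingleColumn⇔ (↭-oneTo⇒unique π↭)) sc))
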